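{- Let $s$ be a positive integer and let $l$ be a positive integer such that there exist integers $k_1,k_2,k_3\geq 3$ with $k_1+k_2+k_3=l$. If $s< R(k_1+1,k_2+1,k_3+1)$, then there exists an $(N,s+3,2s+1)$-suitable core with $N=(s+3)(s-1)+l$.
   Context: Let $v,N,t$ be positive integers and $[v]=\{1,\dots,v\}$. An $N\times v$ array $C$ whose rows are permutations of $[v]$ is an $(N,v,t)$-suitable core if the following holds: choose $N$ new distinct symbols, prepend a different one of them to each row of $C$, and append the remaining $N-1$ new symbols (in arbitrary order) to that row; the resulting $N\times(v+N)$ array has the property that for every $t$-element subset $S$ of the $v+N$ symbols and every $\sigma\in S$ there is a row in which $\sigma$ occurs before every element of $S\setminus\{\sigma\}$. (Equivalently: for every symbol $\sigma\in[v]$ and every subset $T\subseteq[v]\setminus\{\sigma\}$, the number of rows of $C$ in which $\sigma$ precedes every element of $[v]\setminus(T\cup\{\sigma\})$ is at least $t+1-v+|T|$.) $R(k_1,k_2,k_3)$ is the classical three-colour Ramsey number: the least $n$ such that every colouring of the edges of the complete graph $K_n$ with colours $1,2,3$ contains, for some $j$, a complete subgraph on $k_j$ vertices all of whose edges have colour $j$. -}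

module Defs where

open import Data.Nat using (ℕ; zero; suc; _+_; _<_)
open import Data.Fin using (Fin; toℕ)
open import Data.Fin.Permutation using (Permutation′; _⟨$⟩ʳ_; _⟨$⟩ˡ_)
open import Data.Sum using (_⊎_; inj₁; inj₂)
open import Data.Product using (Σ; _×_)
open import Data.List using (List; length)
open import Data.List.Membership.Propositional using (_∈_)
open import Data.List.Relation.Unary.Unique.Propositional using (Unique)
open import Relation.Binary.PropositionalEquality using (_≡_; _≢_)
open import Relation.Nullary using (¬_; yes; no)
open import Function.Definitions using (Injective)
import Data.Fin as F

-- An edge 3-colouring of K_n: a symmetric map on pairs of vertices
-- (the values on the diagonal are irrelevant).
Colouring : ℕ → Set
Colouring n = Fin n → Fin n → Fin 3

Symmetric : ∀ {n} → Colouring n → Set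
Symmetric {n} c = ∀ (i j : Fin n) → c i j ≡ c j i

MonoClique : ∀ {n} → Colouring n → ℕ → Fin 3 → Set
MonoClique {n} c k j =
  Σ (Fin k → Fin n) λ f → Injective _≡_ _≡_ f × (∀ a b → a ≢ b → c (f a) (f b) ≡ j)

RamseyProperty : ℕ → ℕ → ℕ → ℕ → Set
RamseyProperty k₁ k₂ k₃ n =
  (c : Colouring n) → Symmetric c →
  MonoClique c k₁ F.zero ⊎ MonoClique c k₂ (F.suc F.zero) ⊎ MonoClique c k₃ (F.suc (F.suc F.zero))

IsRamseyNumber : ℕ → ℕ → ℕ → ℕ → Set
IsRamseyNumber k₁ k₂ k₃ R =
  RamseyProperty k₁ k₂ k₃ R × (∀ m → m < R → ¬ RamseyProperty k₁ k₂ k₃ m)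

-- An N × v array whose rows are permutations of [v] (= Fin v).
-- Row r lists the symbols: position p holds symbol (C r ⟨$⟩ʳ p).
Core : ℕ → ℕ → Set
Core N v = Fin N → Permutation′ v

-- Symbols of the extended array: old symbols Fin v, new symbols Fin N.
Symbol : ℕ → ℕ → Set
Symbol N v = Fin v ⊎ Fin N

-- Position of a symbol in row r of the extended N × (v+N) array:
-- new symbol r is prepended (position 0), old symbol x is at
-- position 1 + (its position in row r of C), and the remaining new
-- symbols are appended after all old ones, in increasing index order.
-- (Positions are only compared, so gaps are harmless.)
position : ∀ {N v} → Core N v → Fin N → Symbol N v → ℕ
position C r (inj₁ x) = suc (toℕ (C r ⟨$⟩ˡ x))
position {N} {v} C r (inj₂ m) with m F.≟ r
... | yes _ = zero
... | no _  = suc (v + suc (toℕ m))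

SuitableCore : ∀ {N v} → ℕ → Core N v → Set
SuitableCore {N} {v} t C =
  (S : List (Symbol N v)) → Unique S → length S ≡ t →
  (σ : Symbol N v) → σ ∈ S →
  Σ (Fin N) λ r → ∀ τ → τ ∈ S → τ ≢ σ → position C r σ < position C r τ

module Submission where

-- Write s = sp + 1. Since s < R(k₁+1, k₂+1, k₃+1), some colouring c of K_s has no (k_j+1)-clique of colour j.
-- The core uses the s vertices and one special symbol per colour; each row is only prescribed on its first three
-- entries: a row (a, b, special j) for every ordered pair of distinct vertices, where j ≠ c a b is chosen so that
-- (a, b) and (b, a) end with the two colours other than c a b, and k_j + s - 1 rows led by special j, whose second
-- entries run through all other symbols.  This gives exactly (s + 3)(s - 1) + k₁ + k₂ + k₃ rows.
-- A new symbol comes first in its own row.  For an old symbol x and a set S of 2s + 1 symbols containing it, it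
-- suffices to find a row led by x among the old symbols of S whose new symbol is not in S.  We list 2s + 2 distinct
-- candidates, each either a member of S or the new symbol of such a row, and conclude by pigeonhole: the rows led
-- by x, and for every other symbol z either z itself or a row (z, x, …).  When x is the special symbol of colour j
-- there are too few rows (special j, …) to cover the vertices outside S that way; instead, scanning these vertices,
-- each one with an edge of colour ≠ j to a later one yields the row (a, b, special j) or (b, a, special j) led by x
-- among S, and the remaining vertices form a j-clique, so there are at most k_j of them.

open import Defs
open import Data.Nat using (ℕ; suc; _+_; _*_; _∸_; _≤_; _<_)
open import Data.Product using (Σ; _×_)
open import Relation.Binary.PropositionalEquality using (_≡_)

open import Data.Nat using (zero; z≤n; s≤s)
open import Data.Nat.Properties using (≤-trans; ≤-reflexive; ≰⇒>; <⇒≱; _≤?_; +-suc; +-comm; +-monoʳ-≤;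
  m≤m+n; module ≤-Reasoning)
open import Data.Nat.Tactic.RingSolver using (solve-∀)
open import Data.Fin using (Fin; zero; suc; toℕ; inject≤; _↑ˡ_; _↑ʳ_; splitAt; punchIn; punchOut)
import Data.Fin as F
open import Data.Fin.Patterns using (0F; 1F; 2F)
open import Data.Fin.Properties using (any?; all?; _<?_; <-asym; <-cmp; inject≤-injective; toℕ-↑ˡ; toℕ-↑ʳ;
  toℕ<n; ↑ˡ-injective; ↑ʳ-injective; splitAt-↑ˡ; splitAt-↑ʳ; splitAt⁻¹-↑ˡ; splitAt⁻¹-↑ʳ;
  suc-injective; punchIn-punchOut; punchInᵢ≢i; punchIn-injective)
  renaming (pigeonhole to Fin-pigeonhole)
open import Data.Fin.Permutation as Perm using (Permutation′; _⟨$⟩ʳ_; _⟨$⟩ˡ_; inverseʳ; inverseˡ; insert)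
import Data.Vec as Vec
open import Data.Vec.Properties using (lookup∘tabulate)
open import Data.List as List using (List; []; _∷_; _++_; length; map; filter; tabulate; allFin; concatMap)
open import Data.List.Properties using (length-++; length-map; length-tabulate)
open import Data.List.Membership.Propositional using (_∈_; _∉_; find)
open import Data.List.Membership.Propositional.Properties using (∈-lookup; ∈-tabulate⁺; ∈-map⁺; ∈-++⁺ˡ;
  ∈-++⁺ʳ; ∈-concat⁺′; ∈-allFin; ∈-filter⁻)
import Data.List.Membership.DecPropositional as DecMembership
open import Data.List.Relation.Unary.All as All using (All; []; _∷_)
import Data.List.Relation.Unary.All.Properties as All
open import Data.List.Relation.Unary.Any using (here; there; index)
open import Data.List.Relation.Unary.Any.Properties using (lookup-index)
open import Data.List.Relation.Unary.AllPairs as AllPairs using (AllPairs; []; _∷_)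
import Data.List.Relation.Unary.AllPairs.Properties as AllPairs
open import Data.List.Relation.Unary.Unique.Propositional using (Unique)
import Data.List.Relation.Unary.Unique.Propositional.Properties as Unique
open import Data.List.Relation.Binary.Disjoint.Propositional using (Disjoint)
open import Data.Product using (∃; _,_; proj₁; proj₂)
import Data.Product as Product
open import Data.Sum using (_⊎_; inj₁; inj₂)
import Data.Sum.Properties as Sum
open import Data.Empty using (⊥; ⊥-elim)
open import Function using (_∘_)
open import Function.Definitions using (Injective)
open import Relation.Binary.Definitions using (DecidableEquality; tri<; tri≈; tri>)
open import Relation.Binary.PropositionalEquality using (_≢_; refl; sym; trans; cong; cong₂; subst; subst₂;
  module ≡-Reasoning)
open import Relation.Nullary using (¬_; Dec; yes; no; ¬?)
open import Relation.Nullary.Decidable using (map′; _×-dec_; _⊎-dec_; _→-dec_)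
open import Relation.Unary using (Decidable)
open import Relation.Unary.Properties using (∁?)

Searchable : Set → Set₁
Searchable A = ∀ {P : A → Set} → Decidable P → Dec (∃ P)

search-Vec : ∀ {A} → Searchable A → ∀ n → Searchable (Vec.Vec A n)
search-Vec search zero    P? = map′ (Vec.[] ,_) (λ { (Vec.[] , p) → p }) (P? Vec.[])
search-Vec search (suc n) P? =
  map′ (λ (a , w , p) → a Vec.∷ w , p) (λ { (a Vec.∷ w , p) → a , w , p })
       (search (λ a → search-Vec search n (λ w → P? (a Vec.∷ w))))

module _ {n : ℕ} where

  IsMonoClique : ∀ {k} → Colouring n → Fin 3 → (Fin k → Fin n) → Set
  IsMonoClique c j f = Injective _≡_ _≡_ f × (∀ a b → a ≢ b → c (f a) (f b) ≡ j)

  IsMonoClique-resp : ∀ {k} {c d : Colouring n} {j} {f g : Fin k → Fin n} →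
                      (∀ x y → c x y ≡ d x y) → (∀ a → f a ≡ g a) →
                      IsMonoClique c j f → IsMonoClique d j g
  IsMonoClique-resp {c = c} {d} {j} {f} {g} c≗d f≗g (f-inj , f-col) = g-inj , g-col
    where
    g-inj : Injective _≡_ _≡_ g
    g-inj {a} {b} e = f-inj (trans (f≗g a) (trans e (sym (f≗g b))))
    g-col : ∀ a b → a ≢ b → d (g a) (g b) ≡ j
    g-col a b a≢b = trans (sym (c≗d (g a) (g b)))
                          (subst₂ (λ x y → c x y ≡ j) (f≗g a) (f≗g b) (f-col a b a≢b))

  isMonoClique? : ∀ {k} (c : Colouring n) j (f : Fin k → Fin n) → Dec (IsMonoClique c j f)
  isMonoClique? c j f = injective? ×-dec all? λ a → all? λ b → ¬? (a F.≟ b) →-dec (c (f a) (f b) F.≟ j)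
    where
    injective? : Dec (Injective _≡_ _≡_ f)
    injective? = map′ (λ inj {a} {b} → inj a b) (λ inj a b → inj {a} {b})
                      (all? λ a → all? λ b → (f a F.≟ f b) →-dec (a F.≟ b))

  monoClique? : (c : Colouring n) (k : ℕ) (j : Fin 3) → Dec (MonoClique c k j)
  monoClique? c k j =
    map′ (λ (w , p) → Vec.lookup w , p)
         (λ (f , p) → Vec.tabulate f , IsMonoClique-resp {c = c} (λ _ _ → refl) (λ a → sym (lookup∘tabulate f a)) p)
         (search-Vec any? k (isMonoClique? c j ∘ Vec.lookup))

  Avoids : ℕ → ℕ → ℕ → Colouring n → Set
  Avoids k₁ k₂ k₃ c = Symmetric c × ¬ MonoClique c k₁ 0F × ¬ MonoClique c k₂ 1F × ¬ MonoClique c k₃ 2F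

  Avoids-resp : ∀ {k₁ k₂ k₃} {c d : Colouring n} → (∀ x y → c x y ≡ d x y) →
                Avoids k₁ k₂ k₃ c → Avoids k₁ k₂ k₃ d
  Avoids-resp {c = c} {d} c≗d (c-sym , ¬K₁ , ¬K₂ , ¬K₃) =
    (λ x y → trans (sym (c≗d x y)) (trans (c-sym x y) (c≗d y x))) ,
    ¬K₁ ∘ transport , ¬K₂ ∘ transport , ¬K₃ ∘ transport
    where
    transport : ∀ {k j} → MonoClique d k j → MonoClique c k j
    transport (f , p) = f , IsMonoClique-resp (λ x y → sym (c≗d x y)) (λ _ → refl) p

  avoids? : ∀ k₁ k₂ k₃ (c : Colouring n) → Dec (Avoids k₁ k₂ k₃ c)
  avoids? k₁ k₂ k₃ c =
    all? (λ x → all? λ y → c x y F.≟ c y x) ×-dec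
    ¬? (monoClique? c k₁ 0F) ×-dec ¬? (monoClique? c k₂ 1F) ×-dec ¬? (monoClique? c k₃ 2F)

  fromTable : Vec.Vec (Vec.Vec (Fin 3) n) n → Colouring n
  fromTable w x y = Vec.lookup (Vec.lookup w x) y

  fromTable-tabulate : ∀ (c : Colouring n) x y → c x y ≡ fromTable (Vec.tabulate (Vec.tabulate ∘ c)) x y
  fromTable-tabulate c x y =
    sym (trans (cong (λ row → Vec.lookup row y) (lookup∘tabulate (Vec.tabulate ∘ c) x)) (lookup∘tabulate (c x) y))

  avoidingColouring : ∀ {k₁ k₂ k₃} → ¬ RamseyProperty k₁ k₂ k₃ n → Σ (Colouring n) (Avoids k₁ k₂ k₃)
  avoidingColouring {k₁} {k₂} {k₃} ¬ramsey with search-Vec (search-Vec any? n) n (avoids? k₁ k₂ k₃ ∘ fromTable)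
  ... | yes (w , avoids) = fromTable w , avoids
  ... | no ¬avoids = ⊥-elim (¬ramsey ramsey)
    where
    ramsey : RamseyProperty k₁ k₂ k₃ n
    ramsey c c-sym with monoClique? c k₁ 0F ⊎-dec monoClique? c k₂ 1F ⊎-dec monoClique? c k₃ 2F
    ... | yes clique = clique
    ... | no ¬clique = ⊥-elim (¬avoids (Vec.tabulate (Vec.tabulate ∘ c) , Avoids-resp (fromTable-tabulate c)
            (c-sym , ¬clique ∘ inj₁ , ¬clique ∘ inj₂ ∘ inj₁ , ¬clique ∘ inj₂ ∘ inj₂)))

module _ {A : Set} where

  lookup-AllPairs : ∀ {R : A → A → Set} {xs : List A} → AllPairs R xs →
                    ∀ {i j} → i F.< j → R (List.lookup xs i) (List.lookup xs j)
  lookup-AllPairs {xs = _ ∷ xs} (x~xs ∷ _)   {zero}  {suc j} _         = All.lookup x~xs (∈-lookup {xs = xs} j)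
  lookup-AllPairs               (_ ∷ xs~xs) {suc i} {suc j} (s≤s i<j) = lookup-AllPairs xs~xs i<j

  Unique-lookup-injective : ∀ {xs : List A} → Unique xs →
                            ∀ {i j} → List.lookup xs i ≡ List.lookup xs j → i ≡ j
  Unique-lookup-injective xs! {i} {j} eq with <-cmp i j
  ... | tri< i<j _ _ = ⊥-elim (lookup-AllPairs xs! i<j eq)
  ... | tri≈ _ i≡j _ = i≡j
  ... | tri> _ _ j<i = ⊥-elim (lookup-AllPairs xs! j<i (sym eq))

  module _ {xs ys : List A} (xs⊆ys : All (_∈ ys) xs) where

    indexIn : Fin (length xs) → Fin (length ys)
    indexIn i = index (All.lookup xs⊆ys (∈-lookup {xs = xs} i))

    lookup-indexIn : ∀ i → List.lookup xs i ≡ List.lookup ys (indexIn i)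
    lookup-indexIn i = lookup-index (All.lookup xs⊆ys (∈-lookup {xs = xs} i))

  Unique⊆⇒length≤ : ∀ {xs ys : List A} → Unique xs → All (_∈ ys) xs → length xs ≤ length ys
  Unique⊆⇒length≤ {xs} {ys} xs! xs⊆ys with length xs ≤? length ys
  ... | yes |xs|≤|ys| = |xs|≤|ys|
  ... | no  |xs|≰|ys| with Fin-pigeonhole (≰⇒> |xs|≰|ys|) (indexIn xs⊆ys)
  ...   | i , j , i<j , same-index = ⊥-elim (lookup-AllPairs xs! i<j (begin
    List.lookup xs i                     ≡⟨ lookup-indexIn xs⊆ys i ⟩
    List.lookup ys (indexIn xs⊆ys i)     ≡⟨ cong (List.lookup ys) same-index ⟩
    List.lookup ys (indexIn xs⊆ys j)     ≡⟨ lookup-indexIn xs⊆ys j ⟨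
    List.lookup xs j                     ∎))
    where open ≡-Reasoning

  module _ (_≟_ : DecidableEquality A) where
    open DecMembership _≟_ using (_∈?_)

    pigeonhole : ∀ {xs ys : List A} → Unique xs → length ys < length xs → ∃ λ x → x ∈ xs × x ∉ ys
    pigeonhole {xs} {ys} xs! |ys|<|xs| with All.all? (_∈? ys) xs
    ... | yes xs⊆ys = ⊥-elim (<⇒≱ |ys|<|xs| (Unique⊆⇒length≤ xs! xs⊆ys))
    ... | no  xs⊈ys = find (All.¬All⇒Any¬ (_∈? ys) xs xs⊈ys)

  disjoint-by : ∀ {P Q : A → Set} {xs ys} → All P xs → All Q ys → (∀ {a} → P a → Q a → ⊥) →
                Disjoint xs ys
  disjoint-by Pxs Qys P∩Q=∅ (v∈xs , v∈ys) = P∩Q=∅ (All.lookup Pxs v∈xs) (All.lookup Qys v∈ys)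

  length-filter+∁ : ∀ {P : A → Set} (P? : Decidable P) xs →
                    length (filter P? xs) + length (filter (∁? P?) xs) ≡ length xs
  length-filter+∁ P? []       = refl
  length-filter+∁ P? (x ∷ xs) with P? x
  ... | yes _ = cong suc (length-filter+∁ P? xs)
  ... | no  _ = trans (+-suc _ _) (cong suc (length-filter+∁ P? xs))

module _ {n : ℕ} {c : Colouring n} {j : Fin 3} where

  clique-bound : ∀ {k} → Symmetric c → ¬ MonoClique c (suc k) j →
                 ∀ {xs} → Unique xs → AllPairs (λ a b → c a b ≡ j) xs → length xs ≤ k
  clique-bound {k} c-sym ¬K {xs} xs! mono with length xs ≤? k
  ... | yes |xs|≤k = |xs|≤k
  ... | no  |xs|≰k = ⊥-elim (¬K (member , member-injective , member-colour))
    where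
    k<|xs| : suc k ≤ length xs
    k<|xs| = ≰⇒> |xs|≰k
    slot : Fin (suc k) → Fin (length xs)
    slot a = inject≤ a k<|xs|
    member : Fin (suc k) → Fin n
    member a = List.lookup xs (slot a)
    member-injective : ∀ {a b} → member a ≡ member b → a ≡ b
    member-injective eq = inject≤-injective k<|xs| k<|xs| _ _ (Unique-lookup-injective xs! eq)
    member-colour : ∀ a b → a ≢ b → c (member a) (member b) ≡ j
    member-colour a b a≢b with <-cmp (slot a) (slot b)
    ... | tri< a<b _ _ = lookup-AllPairs mono a<b
    ... | tri≈ _ a≡b _ = ⊥-elim (a≢b (inject≤-injective k<|xs| k<|xs| a b a≡b))
    ... | tri> _ _ b<a = trans (c-sym _ _) (lookup-AllPairs mono b<a)

  record OffEdge : Set where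
    constructor offEdge
    field
      source target : Fin n
      distinct : source ≢ target
      off-colour : c source target ≢ j

  open OffEdge public

  record EdgeCover (ws : List (Fin n)) : Set where
    field
      edges : List OffEdge
      clique : List (Fin n)
      edges⊆ : All (λ e → source e ∈ ws × target e ∈ ws) edges
      edges-fresh : AllPairs (λ e e′ → source e ≢ source e′ × source e ≢ target e′) edges
      clique⊆ : All (_∈ ws) clique
      clique-unique : Unique clique
      clique-mono : AllPairs (λ a b → c a b ≡ j) clique
      size : length ws ≡ length edges + length clique

  -- Scan ws from the left: a vertex with an edge of colour ≠ j to a later vertex contributes that edge; the
  -- others have colour j towards everything after them, so they form a j-clique.
  edgeCover : ∀ {ws} → Unique ws → EdgeCover ws
  edgeCover {[]} [] = record
    { edges = [] ; clique = [] ; edges⊆ = [] ; edges-fresh = [] ; clique⊆ = []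
    ; clique-unique = [] ; clique-mono = [] ; size = refl }
  edgeCover {w ∷ ws} (w∉ws ∷ ws!) with All.all? (λ v → c w v F.≟ j) ws
  ... | yes w~ws = record
    { edges = edges ; clique = w ∷ clique
    ; edges⊆ = All.map (Product.map there there) edges⊆
    ; edges-fresh = edges-fresh
    ; clique⊆ = here refl ∷ All.map there clique⊆
    ; clique-unique = All.map (All.lookup w∉ws) clique⊆ ∷ clique-unique
    ; clique-mono = All.map (All.lookup w~ws) clique⊆ ∷ clique-mono
    ; size = trans (cong suc size) (sym (+-suc _ _)) }
    where open EdgeCover (edgeCover ws!)
  ... | no w≁ws with find (All.¬All⇒Any¬ (λ v → c w v F.≟ j) ws w≁ws)
  ...   | v , v∈ws , cwv≢j = record
    { edges = offEdge w v (All.lookup w∉ws v∈ws) cwv≢j ∷ edges ; clique = clique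
    ; edges⊆ = (here refl , there v∈ws) ∷ All.map (Product.map there there) edges⊆
    ; edges-fresh = All.map (Product.map (All.lookup w∉ws) (All.lookup w∉ws)) edges⊆ ∷ edges-fresh
    ; clique⊆ = All.map there clique⊆
    ; clique-unique = clique-unique
    ; clique-mono = clique-mono
    ; size = cong suc size }
    where open EdgeCover (edgeCover ws!)


injective₃ : ∀ {A : Set} {f : Fin 3 → A} → f 0F ≢ f 1F → f 0F ≢ f 2F → f 1F ≢ f 2F → Injective _≡_ _≡_ f
injective₃ a≢b a≢c b≢c {0F} {0F} _ = refl
injective₃ a≢b a≢c b≢c {0F} {1F} e = ⊥-elim (a≢b e)
injective₃ a≢b a≢c b≢c {0F} {2F} e = ⊥-elim (a≢c e)
injective₃ a≢b a≢c b≢c {1F} {0F} e = ⊥-elim (a≢b (sym e))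
injective₃ a≢b a≢c b≢c {1F} {1F} _ = refl
injective₃ a≢b a≢c b≢c {1F} {2F} e = ⊥-elim (b≢c e)
injective₃ a≢b a≢c b≢c {2F} {0F} e = ⊥-elim (a≢c (sym e))
injective₃ a≢b a≢c b≢c {2F} {1F} e = ⊥-elim (b≢c (sym e))
injective₃ a≢b a≢c b≢c {2F} {2F} _ = refl

prefixPermutation : ∀ {k m} (f : Fin k → Fin (k + m)) → Injective _≡_ _≡_ f →
                    Σ (Permutation′ (k + m)) λ π → ∀ i → π ⟨$⟩ʳ (i ↑ˡ m) ≡ f i
prefixPermutation {zero}      f f-inj = Perm.id , λ ()
prefixPermutation {suc k} {m} f f-inj = insert 0F (f 0F) π , placed
  where
  f₀≢ : ∀ i → f 0F ≢ f (suc i)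
  f₀≢ i e with f-inj e
  ... | ()
  rest : Fin k → Fin (k + m)
  rest i = punchOut (f₀≢ i)
  punchIn-rest : ∀ i → punchIn (f 0F) (rest i) ≡ f (suc i)
  punchIn-rest i = punchIn-punchOut (f₀≢ i)
  rest-injective : Injective _≡_ _≡_ rest
  rest-injective {a} {b} e = suc-injective (f-inj (begin
    f (suc a)                   ≡⟨ punchIn-rest a ⟨
    punchIn (f 0F) (rest a)     ≡⟨ cong (punchIn (f 0F)) e ⟩
    punchIn (f 0F) (rest b)     ≡⟨ punchIn-rest b ⟩
    f (suc b)                   ∎))
    where open ≡-Reasoning
  π : Permutation′ (k + m)
  π = proj₁ (prefixPermutation rest rest-injective)
  placed : ∀ i → insert 0F (f 0F) π ⟨$⟩ʳ (i ↑ˡ m) ≡ f i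
  placed 0F      = refl
  placed (suc i) = trans (cong (punchIn (f 0F)) (proj₂ (prefixPermutation rest rest-injective) i))
                         (punchIn-rest i)

module _ {k m : ℕ} (π : Permutation′ (k + m)) (f : Fin k → Fin (k + m))
         (placed : ∀ i → π ⟨$⟩ʳ (i ↑ˡ m) ≡ f i) where

  prefix-precedes : ∀ i y → y ≢ f i → (∀ j → j F.< i → y ≢ f j) →
                    toℕ (π ⟨$⟩ˡ f i) < toℕ (π ⟨$⟩ˡ y)
  prefix-precedes i y y≢fi y≢earlier =
    subst (λ p → toℕ p < toℕ (π ⟨$⟩ˡ y)) (sym position-fi) (before (π ⟨$⟩ˡ y) (inverseʳ π))
    where
    position-fi : π ⟨$⟩ˡ f i ≡ i ↑ˡ m
    position-fi = trans (cong (π ⟨$⟩ˡ_) (sym (placed i))) (inverseˡ π)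
    before : ∀ p → π ⟨$⟩ʳ p ≡ y → toℕ (i ↑ˡ m) < toℕ p
    before p πp≡y with splitAt k p in split
    ... | inj₂ q = begin-strict
      toℕ (i ↑ˡ m)   ≡⟨ toℕ-↑ˡ i m ⟩
      toℕ i          <⟨ toℕ<n i ⟩
      k              ≤⟨ m≤m+n k (toℕ q) ⟩
      k + toℕ q      ≡⟨ toℕ-↑ʳ k q ⟨
      toℕ (k ↑ʳ q)   ≡⟨ cong toℕ (splitAt⁻¹-↑ʳ split) ⟩
      toℕ p          ∎
      where open ≤-Reasoning
    ... | inj₁ j with <-cmp i j | trans (sym πp≡y) (trans (cong (π ⟨$⟩ʳ_) (sym (splitAt⁻¹-↑ˡ split))) (placed j))
    ...   | tri< i<j _ _ | _    =
      subst₂ _<_ (sym (toℕ-↑ˡ i m)) (trans (sym (toℕ-↑ˡ j m)) (cong toℕ (splitAt⁻¹-↑ˡ split))) i<j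
    ...   | tri≈ _ i≡j _ | y≡fj = ⊥-elim (y≢fi (trans y≡fj (cong f (sym i≡j))))
    ...   | tri> _ _ j<i | y≡fj = ⊥-elim (y≢earlier j j<i y≡fj)

Leads : ∀ {N v} → Permutation′ v → List (Symbol N v) → Fin v → Set
Leads π S x = ∀ y → inj₁ y ∈ S → y ≢ x → toℕ (π ⟨$⟩ˡ x) < toℕ (π ⟨$⟩ˡ y)

module _ {N v : ℕ} (C : Core N v) where

  position-self : ∀ r → position C r (inj₂ r) ≡ 0
  position-self r with r F.≟ r
  ... | yes _   = refl
  ... | no r≢r  = ⊥-elim (r≢r refl)

  position-other : ∀ r m → m ≢ r → position C r (inj₂ m) ≡ suc (v + suc (toℕ m))
  position-other r m m≢r with m F.≟ r
  ... | yes m≡r = ⊥-elim (m≢r m≡r)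
  ... | no _    = refl

  -- In row r all new symbols except r itself come after the old ones, so an old symbol x comes first among S
  -- there as soon as it leads the old symbols of S and r ∉ S.
  suitable-if-leading-rows : ∀ t →
    (∀ S → Unique S → length S ≡ t → ∀ x → inj₁ x ∈ S → ∃ λ r → inj₂ r ∉ S × Leads (C r) S x) →
    SuitableCore t C
  suitable-if-leading-rows t leading S S! |S| (inj₂ r) _ = r , comes-first
    where
    comes-first : ∀ τ → τ ∈ S → τ ≢ inj₂ r → position C r (inj₂ r) < position C r τ
    comes-first (inj₁ y) _ _ rewrite position-self r = s≤s z≤n
    comes-first (inj₂ m) _ τ≢r rewrite position-self r | position-other r m (λ m≡r → τ≢r (cong inj₂ m≡r)) =
      s≤s z≤n
  suitable-if-leading-rows t leading S S! |S| (inj₁ x) x∈S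
    with leading S S! |S| x x∈S
  ... | r , r∉S , x-leads = r , comes-first
    where
    comes-first : ∀ τ → τ ∈ S → τ ≢ inj₁ x → position C r (inj₁ x) < position C r τ
    comes-first (inj₁ y) y∈S y≢x = s≤s (x-leads y y∈S (λ e → y≢x (cong inj₁ e)))
    comes-first (inj₂ m) m∈S _ rewrite position-other r m (λ { refl → r∉S m∈S }) =
      s≤s (≤-trans (toℕ<n (C r ⟨$⟩ˡ x)) (m≤m+n v (suc (toℕ m))))

  data Witness (S : List (Symbol N v)) (x : Fin v) : Symbol N v → Set where
    present : ∀ {σ} → σ ∈ S → Witness S x σ
    leading : ∀ r → Leads (C r) S x → Witness S x (inj₂ r)

  leading-row-by-pigeonhole : ∀ {S L x} → Unique L → length S < length L → All (Witness S x) L →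
                              ∃ λ r → inj₂ r ∉ S × Leads (C r) S x
  leading-row-by-pigeonhole {S} L! |S|<|L| witnesses
    with pigeonhole (Sum.≡-dec F._≟_ F._≟_) L! |S|<|L|
  ... | σ , σ∈L , σ∉S with All.lookup witnesses σ∈L
  ...   | present σ∈S   = ⊥-elim (σ∉S σ∈S)
  ...   | leading r leads = r , σ∉S , leads


length-concatMap-const : ∀ {A B : Set} (f : A → List B) {k} → (∀ a → length (f a) ≡ k) →
                         ∀ xs → length (concatMap f xs) ≡ length xs * k
length-concatMap-const f |f| []       = refl
length-concatMap-const f |f| (x ∷ xs) =
  trans (length-++ (f x)) (cong₂ _+_ (|f| x) (length-concatMap-const f |f| xs))

orient : ∀ {n} → Fin n → Fin n → Fin 2
orient a b with a <? b
... | yes _ = 0F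
... | no  _ = 1F

orient-covers : ∀ {n} {a b : Fin n} → a ≢ b → ∀ d → d ≡ orient a b ⊎ d ≡ orient b a
orient-covers {a = a} {b} a≢b d with a <? b | b <? a | d
... | yes a<b | yes b<a | _  = ⊥-elim (<-asym a<b b<a)
... | yes _   | no _    | 0F = inj₁ refl
... | yes _   | no _    | 1F = inj₂ refl
... | no _    | yes _   | 0F = inj₂ refl
... | no _    | yes _   | 1F = inj₁ refl
... | no a≮b  | no b≮a  | _  with <-cmp a b
...   | tri< a<b _ _ = ⊥-elim (a≮b a<b)
...   | tri≈ _ a≡b _ = ⊥-elim (a≢b a≡b)
...   | tri> _ _ b<a = ⊥-elim (b≮a b<a)

-- The symbols are one special symbol per colour followed by the s vertices of the colouring c; spare j is
-- k_j - 3, the number of rows led by special j beyond those needed to pair it with every other symbol.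
module Construction (sp : ℕ) (spare : Fin 3 → ℕ) (c : Colouring (suc sp)) where

  s : ℕ
  s = suc sp

  special : Fin 3 → Fin (3 + s)
  special j = j ↑ˡ s

  vertex : Fin s → Fin (3 + s)
  vertex a = 3 ↑ʳ a

  special-injective : ∀ {j j′} → special j ≡ special j′ → j ≡ j′
  special-injective = ↑ˡ-injective s _ _

  vertex-injective : ∀ {a b} → vertex a ≡ vertex b → a ≡ b
  vertex-injective = ↑ʳ-injective 3 _ _

  special≢vertex : ∀ j a → special j ≢ vertex a
  special≢vertex j a e with trans (sym (splitAt-↑ˡ 3 j s)) (trans (cong (splitAt 3) e) (splitAt-↑ʳ 3 s a))
  ... | ()

  data SymbolView : Fin (3 + s) → Set where
    special-view : ∀ j → SymbolView (special j)
    vertex-view  : ∀ a → SymbolView (vertex a)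

  symbolView : ∀ x → SymbolView x
  symbolView x with splitAt 3 x in split
  ... | inj₁ j = subst SymbolView (splitAt⁻¹-↑ˡ split) (special-view j)
  ... | inj₂ a = subst SymbolView (splitAt⁻¹-↑ʳ split) (vertex-view a)

  -- The row of an ordered pair (a, b) of vertices ends with a colour other than c a b; swapping a and b swaps
  -- between the two such colours.
  pairThird : Fin s → Fin s → Fin (3 + s)
  pairThird a b = special (punchIn (c a b) (orient a b))

  data Row : Set where
    pairRow    : Fin s → Fin sp → Row
    specialRow : Fin 3 → Fin (2 + s) → Row
    spareRow   : (j : Fin 3) → Fin (spare j) → Row

  first second third : Row → Fin (3 + s)
  first (pairRow a _)      = vertex a
  first (specialRow j _)   = special j
  first (spareRow j _)     = special j
  second (pairRow a i)     = vertex (punchIn a i)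
  second (specialRow j o)  = punchIn (special j) o
  second (spareRow j _)    = second (specialRow j 0F)
  third (pairRow a i)      = pairThird a (punchIn a i)
  third (specialRow j o)   = punchIn (special j) (punchIn o 0F)
  third (spareRow j _)     = third (specialRow j 0F)

  lead : Row → Fin 3 → Fin (3 + s)
  lead R 0F = first R
  lead R 1F = second R
  lead R 2F = third R

  lead-injective : ∀ R → Injective _≡_ _≡_ (lead R)
  lead-injective (pairRow a i) =
    injective₃ (punchInᵢ≢i a i ∘ sym ∘ vertex-injective)
               (special≢vertex _ a ∘ sym) (special≢vertex _ (punchIn a i) ∘ sym)
  lead-injective (specialRow j o) =
    injective₃ (punchInᵢ≢i _ o ∘ sym) (punchInᵢ≢i _ _ ∘ sym)
               (punchInᵢ≢i o 0F ∘ sym ∘ punchIn-injective (special j) _ _)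
  lead-injective (spareRow j _) =
    injective₃ (punchInᵢ≢i _ 0F ∘ sym) (punchInᵢ≢i _ _ ∘ sym)
               (punchInᵢ≢i 0F 0F ∘ sym ∘ punchIn-injective (special j) _ _)

  -- The row permutations and the list of rows are abstract: unfolding them during unification is prohibitively
  -- expensive.
  abstract
    rowPermutation : Row → Permutation′ (3 + s)
    rowPermutation R = proj₁ (prefixPermutation (lead R) (lead-injective R))

    rowPermutation-prefix : ∀ R i → rowPermutation R ⟨$⟩ʳ (i ↑ˡ s) ≡ lead R i
    rowPermutation-prefix R = proj₂ (prefixPermutation (lead R) (lead-injective R))

  pairRowTo : ∀ a b → a ≢ b → Row
  pairRowTo a b a≢b = pairRow a (punchOut a≢b)

  second-pairRowTo : ∀ a b a≢b → second (pairRowTo a b a≢b) ≡ vertex b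
  second-pairRowTo a b a≢b = cong vertex (punchIn-punchOut a≢b)

  third-pairRowTo : ∀ a b a≢b → third (pairRowTo a b a≢b) ≡ pairThird a b
  third-pairRowTo a b a≢b = cong (pairThird a) (punchIn-punchOut a≢b)

  specialRowTo : ∀ j y → special j ≢ y → Row
  specialRowTo j y j≢y = specialRow j (punchOut j≢y)

  second-specialRowTo : ∀ j y j≢y → second (specialRowTo j y j≢y) ≡ y
  second-specialRowTo j y j≢y = punchIn-punchOut j≢y

  vertexRows : Fin s → List Row
  vertexRows a = tabulate (pairRow a)

  specialRows : Fin 3 → List Row
  specialRows j = tabulate (specialRow j) ++ tabulate (spareRow j)

  abstract
    rows : List Row
    rows = concatMap vertexRows (allFin s) ++ concatMap specialRows (allFin 3)

    row-listed : ∀ R → R ∈ rows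
    row-listed (pairRow a i) =
      ∈-++⁺ˡ (∈-concat⁺′ (∈-tabulate⁺ i) (∈-map⁺ vertexRows (∈-allFin a)))
    row-listed (specialRow j o) = ∈-++⁺ʳ (concatMap vertexRows (allFin s))
      (∈-concat⁺′ (∈-++⁺ˡ (∈-tabulate⁺ {f = specialRow j} o)) (∈-map⁺ specialRows (∈-allFin j)))
    row-listed (spareRow j q) = ∈-++⁺ʳ (concatMap vertexRows (allFin s))
      (∈-concat⁺′ (∈-++⁺ʳ (tabulate (specialRow j)) (∈-tabulate⁺ q)) (∈-map⁺ specialRows (∈-allFin j)))

    length-specialRows : ∀ j → length (specialRows j) ≡ 2 + s + spare j
    length-specialRows j = trans (length-++ (tabulate (specialRow j)))
                                 (cong₂ _+_ (length-tabulate (specialRow j)) (length-tabulate (spareRow j)))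

    length-rows : length rows ≡ (s + 3) * sp + ((3 + spare 0F) + (3 + spare 1F) + (3 + spare 2F))
    length-rows = begin
      length rows
        ≡⟨ length-++ (concatMap vertexRows (allFin s)) ⟩
      length (concatMap vertexRows (allFin s)) + length (concatMap specialRows (allFin 3))
        ≡⟨ cong₂ _+_ (trans (length-concatMap-const vertexRows (length-tabulate ∘ pairRow) (allFin s))
                            (cong (_* sp) (length-tabulate {n = s} (λ a → a))))
                     (trans (length-++ (specialRows 0F)) (cong₂ _+_ (length-specialRows 0F)
                     (trans (length-++ (specialRows 1F)) (cong₂ _+_ (length-specialRows 1F)
                     (trans (length-++ (specialRows 2F)) (cong (_+ 0) (length-specialRows 2F))))))) ⟩
      s * sp + ((2 + s + spare 0F) + ((2 + s + spare 1F) + ((2 + s + spare 2F) + 0)))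
        ≡⟨ count sp (spare 0F) (spare 1F) (spare 2F) ⟩
      (s + 3) * sp + ((3 + spare 0F) + (3 + spare 1F) + (3 + spare 2F)) ∎
      where
      open ≡-Reasoning
      count : ∀ n a b d → suc n * n + ((2 + suc n + a) + ((2 + suc n + b) + ((2 + suc n + d) + 0))) ≡
                          (suc n + 3) * n + ((3 + a) + (3 + b) + (3 + d))
      count = solve-∀

    encode : Row → Fin (length rows)
    encode R = index (row-listed R)

    lookup-encode : ∀ R → List.lookup rows (encode R) ≡ R
    lookup-encode R = sym (lookup-index (row-listed R))

  N : ℕ
  N = length rows

  C : Core N (3 + s)
  C r = rowPermutation (List.lookup rows r)

  C-encode : ∀ R → C (encode R) ≡ rowPermutation R
  C-encode R = cong rowPermutation (lookup-encode R)

  Symbol′ : Set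
  Symbol′ = Symbol N (3 + s)

  _≟ˢ_ : DecidableEquality Symbol′
  _≟ˢ_ = Sum.≡-dec F._≟_ F._≟_

  new : Row → Symbol′
  new R = inj₂ (encode R)

  new-injective : ∀ {R R′} → new R ≡ new R′ → R ≡ R′
  new-injective {R} {R′} e =
    trans (sym (lookup-encode R)) (trans (cong (List.lookup rows) (Sum.inj₂-injective e)) (lookup-encode R′))

  key : Symbol′ → Fin (3 + s)
  key (inj₁ y) = y
  key (inj₂ r) = first (List.lookup rows r)

  key-new : ∀ R → key (new R) ≡ first R
  key-new R = cong first (lookup-encode R)

  row-leads : ∀ {S : List Symbol′} {x} R i → lead R i ≡ x → (∀ j → j F.< i → inj₁ (lead R j) ∉ S) →
              Leads (C (encode R)) S x
  row-leads {S} R i refl earlier∉S =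
    subst (λ π → Leads π S (lead R i)) (sym (C-encode R))
          (λ y y∈S y≢x → prefix-precedes (rowPermutation R) (lead R)
                           (rowPermutation-prefix R) i y y≢x
                           (λ j j<i y≡ → earlier∉S j j<i (subst (λ z → inj₁ z ∈ S) y≡ y∈S)))

  data Joins (a b : Fin s) (R : Row) : Set where
    forward  : first R ≡ vertex a → second R ≡ vertex b → Joins a b R
    backward : first R ≡ vertex b → second R ≡ vertex a → Joins a b R

  joins-source : ∀ {a b a′ b′ R} → Joins a b R → Joins a′ b′ R → a ≡ a′ ⊎ a ≡ b′
  joins-source (forward  f _) (forward  f′ _) = inj₁ (vertex-injective (trans (sym f) f′))
  joins-source (forward  f _) (backward f′ _) = inj₂ (vertex-injective (trans (sym f) f′))
  joins-source (backward _ g) (forward  _ g′) = inj₂ (vertex-injective (trans (sym g) g′))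
  joins-source (backward _ g) (backward _ g′) = inj₁ (vertex-injective (trans (sym g) g′))

  joins-first : ∀ {a b R} → Joins a b R → ∃ λ v → first R ≡ vertex v
  joins-first (forward  f _) = _ , f
  joins-first (backward f _) = _ , f

  joins-absent : ∀ {S : List Symbol′} {a b R} → Joins a b R → inj₁ (vertex a) ∉ S → inj₁ (vertex b) ∉ S →
                 inj₁ (first R) ∉ S × inj₁ (second R) ∉ S
  joins-absent {S} (forward f g) a∉S b∉S =
    subst (λ z → inj₁ z ∉ S) (sym f) a∉S , subst (λ z → inj₁ z ∉ S) (sym g) b∉S
  joins-absent {S} (backward f g) a∉S b∉S =
    subst (λ z → inj₁ z ∉ S) (sym f) b∉S , subst (λ z → inj₁ z ∉ S) (sym g) a∉S

  orientedRow : Symmetric c → ∀ {j} (e : OffEdge {c = c} {j}) →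
                Σ Row λ R → Joins (source e) (target e) R × third R ≡ special j
  orientedRow c-sym {j} (offEdge a b a≢b cab≢j) with orient-covers a≢b (punchOut cab≢j)
  ... | inj₁ d≡ab = pairRowTo a b a≢b , forward refl (second-pairRowTo a b a≢b) , (begin
    third (pairRowTo a b a≢b)                      ≡⟨ third-pairRowTo a b a≢b ⟩
    special (punchIn (c a b) (orient a b))         ≡⟨ cong (special ∘ punchIn (c a b)) d≡ab ⟨
    special (punchIn (c a b) (punchOut cab≢j))     ≡⟨ cong special (punchIn-punchOut cab≢j) ⟩
    special j                                      ∎)
    where open ≡-Reasoning
  ... | inj₂ d≡ba = pairRowTo b a (a≢b ∘ sym) , backward refl (second-pairRowTo b a (a≢b ∘ sym)) , (begin
    third (pairRowTo b a (a≢b ∘ sym))              ≡⟨ third-pairRowTo b a (a≢b ∘ sym) ⟩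
    special (punchIn (c b a) (orient b a))         ≡⟨ cong special (cong₂ punchIn (c-sym b a) (sym d≡ba)) ⟩
    special (punchIn (c a b) (punchOut cab≢j))     ≡⟨ cong special (punchIn-punchOut cab≢j) ⟩
    special j                                      ∎)
    where open ≡-Reasoning

  IsOld IsNew : Symbol′ → Set
  IsOld σ = ∃ λ y → σ ≡ inj₁ y
  IsNew σ = ∃ λ r → σ ≡ inj₂ r

  SpecialKey VertexKey : Symbol′ → Set
  SpecialKey σ = ∃ λ j → key σ ≡ special j
  VertexKey σ = ∃ λ a → key σ ≡ vertex a

  special-vertex-disjoint : ∀ {xs ys} → All SpecialKey xs → All VertexKey ys → Disjoint xs ys
  special-vertex-disjoint specials vertices =
    disjoint-by specials vertices (λ (j , kj) (a , ka) → special≢vertex j a (trans (sym kj) ka))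

  tabulate-unique-by-key : ∀ {k} (σ : Fin k → Symbol′) (h : Fin k → Fin (3 + s)) →
                           (∀ i → key (σ i) ≡ h i) → Injective _≡_ _≡_ h → Unique (tabulate σ)
  tabulate-unique-by-key σ h σ-key h-injective =
    Unique.tabulate⁺ (λ {i} {j} e → h-injective (trans (sym (σ-key i)) (trans (cong key e) (σ-key j))))

  module Candidates (S : List Symbol′) (x : Fin (3 + s)) where

    open DecMembership _≟ˢ_ using (_∈?_)

    -- A row R led by z = first R and then x stands for z: either z is in S, or x leads the old symbols of S in R.
    fallback : Row → Symbol′
    fallback R with inj₁ (first R) ∈? S
    ... | yes _ = inj₁ (first R)
    ... | no  _ = new R

    key-fallback : ∀ R → key (fallback R) ≡ first R
    key-fallback R with inj₁ (first R) ∈? S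
    ... | yes _ = refl
    ... | no  _ = key-new R

    witness-fallback : ∀ R → second R ≡ x → Witness C S x (fallback R)
    witness-fallback R second≡x with inj₁ (first R) ∈? S
    ... | yes first∈S = present first∈S
    ... | no  first∉S = leading (encode R) (row-leads R 1F second≡x λ { 0F _ → first∉S ; (suc _) (s≤s ()) })

    record CandidateList : Set where
      field
        led : List Row
        others : List Symbol′
        led-unique : Unique led
        led-first : All (λ R → first R ≡ x) led
        others-unique : Unique others
        others-key : All (λ σ → key σ ≢ x) others
        others-witness : All (Witness C S x) others
        long : 2 * s + 1 ≤ length led + length others

    leadingRow : inj₁ x ∈ S → length S ≡ 2 * s + 1 → CandidateList → ∃ λ r → inj₂ r ∉ S × Leads (C r) S x
    leadingRow x∈S |S| candidates =
      leading-row-by-pigeonhole C (x∉rest ∷ rest-unique) |S|<|L| (present x∈S ∷ rest-witness)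
      where
      open CandidateList candidates
      rest : List Symbol′
      rest = map new led ++ others
      led-keys : All (λ σ → key σ ≡ x) (map new led)
      led-keys = All.map⁺ (All.map (λ {R} first≡x → trans (key-new R) first≡x) led-first)
      x∉rest : All (inj₁ x ≢_) rest
      x∉rest = All.++⁺ (All.map⁺ (All.tabulate (λ _ ())))
                       (All.map (λ key≢x e → key≢x (sym (cong key e))) others-key)
      rest-unique : Unique rest
      rest-unique = Unique.++⁺ (Unique.map⁺ new-injective led-unique) others-unique
                               (disjoint-by led-keys others-key (λ key≡x key≢x → key≢x key≡x))
      rest-witness : All (Witness C S x) rest
      rest-witness = All.++⁺ (All.map⁺ (All.map (λ {R} first≡x → leading (encode R) (row-leads R 0F first≡x λ _ ()))
                                                 led-first))
                             others-witness
      |S|<|L| : length S < suc (length rest)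
      |S|<|L| = s≤s (begin
        length S                          ≡⟨ |S| ⟩
        2 * s + 1                         ≤⟨ long ⟩
        length led + length others        ≡⟨ cong (_+ length others) (length-map new led) ⟨
        length (map new led) + length others ≡⟨ length-++ (map new led) ⟨
        length rest                       ∎)
        where open ≤-Reasoning

  module _ (S : List Symbol′) (a : Fin s) where
    open Candidates S (vertex a)

    -- Besides the rows starting with vertex a, every other symbol z contributes z itself or the row (z, vertex a, …).
    vertexCandidates : CandidateList
    vertexCandidates = record
      { led = tabulate (pairRow a)
      ; others = tabulate viaSpecial ++ tabulate viaVertex
      ; led-unique = Unique.tabulate⁺ {f = pairRow a} λ { refl → refl }
      ; led-first = All.tabulate⁺ {f = pairRow a} λ _ → refl
      ; others-unique = Unique.++⁺
          (tabulate-unique-by-key viaSpecial special viaSpecial-key special-injective)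
          (tabulate-unique-by-key viaVertex (vertex ∘ punchIn a) viaVertex-key
                                  (punchIn-injective a _ _ ∘ vertex-injective))
          (special-vertex-disjoint (All.tabulate⁺ {f = viaSpecial} λ j → j , viaSpecial-key j)
                                   (All.tabulate⁺ {f = viaVertex} λ i → punchIn a i , viaVertex-key i))
      ; others-key = All.++⁺
          (All.tabulate⁺ {f = viaSpecial} λ j e → special≢vertex j a (trans (sym (viaSpecial-key j)) e))
          (All.tabulate⁺ {f = viaVertex} λ i e → punchInᵢ≢i a i (vertex-injective (trans (sym (viaVertex-key i)) e)))
      ; others-witness = All.++⁺
          (All.tabulate⁺ {f = viaSpecial} λ j →
             witness-fallback (toSpecial j) (second-specialRowTo j (vertex a) (special≢vertex j a)))
          (All.tabulate⁺ {f = viaVertex} λ i →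
             witness-fallback (toVertex i) (second-pairRowTo (punchIn a i) a (punchInᵢ≢i a i)))
      ; long = ≤-reflexive (begin
          2 * s + 1
            ≡⟨ count sp ⟩
          sp + (3 + sp)
            ≡⟨ cong₂ _+_ (length-tabulate (pairRow a))
                         (cong₂ _+_ (length-tabulate viaSpecial) (length-tabulate viaVertex)) ⟨
          length (tabulate (pairRow a)) + (length (tabulate viaSpecial) + length (tabulate viaVertex))
            ≡⟨ cong (length (tabulate (pairRow a)) +_) (length-++ (tabulate viaSpecial) {tabulate viaVertex}) ⟨
          length (tabulate (pairRow a)) + length (tabulate viaSpecial ++ tabulate viaVertex) ∎)
      }
      where
      open ≡-Reasoning
      toSpecial : Fin 3 → Row
      toSpecial j = specialRowTo j (vertex a) (special≢vertex j a)
      toVertex : Fin sp → Row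
      toVertex i = pairRowTo (punchIn a i) a (punchInᵢ≢i a i)
      viaSpecial : Fin 3 → Symbol′
      viaSpecial = fallback ∘ toSpecial
      viaVertex : Fin sp → Symbol′
      viaVertex = fallback ∘ toVertex
      viaSpecial-key : ∀ j → key (viaSpecial j) ≡ special j
      viaSpecial-key = key-fallback ∘ toSpecial
      viaVertex-key : ∀ i → key (viaVertex i) ≡ vertex (punchIn a i)
      viaVertex-key = key-fallback ∘ toVertex
      count : ∀ n → 2 * suc n + 1 ≡ n + (3 + n)
      count = solve-∀

  module _ (c-sym : Symmetric c) (no-clique : ∀ j → ¬ MonoClique c (suc (3 + spare j)) j)
           (S : List Symbol′) (j : Fin 3) where
    open Candidates S (special j)
    open DecMembership _≟ˢ_ using (_∈?_)

    private
      inS? : Decidable (λ b → inj₁ (vertex b) ∈ S)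
      inS? b = inj₁ (vertex b) ∈? S
      inside outside : List (Fin s)
      inside  = filter inS? (allFin s)
      outside = filter (∁? inS?) (allFin s)
      edgeRow : OffEdge {c = c} {j = j} → Row
      edgeRow e = proj₁ (orientedRow c-sym e)
      toOther : Fin 2 → Row
      toOther t = specialRowTo (punchIn j t) (special j) (punchInᵢ≢i j t ∘ special-injective)
      viaOther : Fin 2 → Symbol′
      viaOther = fallback ∘ toOther

    open EdgeCover (edgeCover {c = c} {j = j} (Unique.filter⁺ (∁? inS?) (Unique.allFin⁺ s)))

    private
      viaVertices : List Symbol′
      viaVertices = map (inj₁ ∘ vertex) inside ++ map (new ∘ edgeRow) edges

    -- The vertices outside S are covered by the rows of the edges of colour ≠ j found by edgeCover, which all end
    -- with special j, except for a j-clique of at most 3 + spare j vertices.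
    specialCandidates : CandidateList
    specialCandidates = record
      { led = specialRows j
      ; others = tabulate viaOther ++ viaVertices
      ; led-unique = Unique.++⁺ (Unique.tabulate⁺ {f = specialRow j} λ { refl → refl })
                                (Unique.tabulate⁺ {f = spareRow j} λ { refl → refl })
          (disjoint-by (All.tabulate⁺ {P = λ R → ∃ λ o → R ≡ specialRow j o} {f = specialRow j} λ o → o , refl)
                       (All.tabulate⁺ {P = λ R → ∃ λ q → R ≡ spareRow j q} {f = spareRow j} λ q → q , refl)
                       λ { (_ , refl) (_ , ()) })
      ; led-first = All.++⁺ (All.tabulate⁺ {f = specialRow j} λ _ → refl) (All.tabulate⁺ {f = spareRow j} λ _ → refl)
      ; others-unique = Unique.++⁺
          (tabulate-unique-by-key viaOther (special ∘ punchIn j) viaOther-key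
                                  (punchIn-injective j _ _ ∘ special-injective))
          (Unique.++⁺ (Unique.map⁺ (vertex-injective ∘ Sum.inj₁-injective) (Unique.filter⁺ inS? (Unique.allFin⁺ s)))
                      edgeRows-unique
                      (disjoint-by {P = IsOld} {Q = IsNew}
                                   (All.map⁺ {f = inj₁ ∘ vertex} (All.tabulate λ {b} _ → vertex b , refl))
                                   (All.map⁺ {f = new ∘ edgeRow} (All.tabulate λ {e} _ → encode (edgeRow e) , refl))
                                   λ { (_ , refl) (_ , ()) }))
          (special-vertex-disjoint (All.tabulate⁺ {f = viaOther} λ t → punchIn j t , viaOther-key t) vertex-keys)
      ; others-key = All.++⁺
          (All.tabulate⁺ {f = viaOther} λ t e → punchInᵢ≢i j t (special-injective (trans (sym (viaOther-key t)) e)))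
          (All.map (λ (b , kb) e → special≢vertex j b (trans (sym e) kb)) vertex-keys)
      ; others-witness = All.++⁺
          (All.tabulate⁺ {f = viaOther} λ t →
             witness-fallback (toOther t) (second-specialRowTo (punchIn j t) (special j) _))
          (All.++⁺ (All.map⁺ (All.tabulate λ b∈inside → present (proj₂ (∈-filter⁻ inS? b∈inside))))
                   (All.map⁺ (All.map edge-witness edges⊆)))
      ; long = subst (2 * s + 1 ≤_) (sym lengths)
                     (count (trans (length-filter+∁ inS? (allFin s)) (length-tabulate {n = s} (λ b → b))) size
                            (clique-bound c-sym (no-clique j) clique-unique clique-mono))
      }
      where
      viaOther-key : ∀ t → key (viaOther t) ≡ special (punchIn j t)
      viaOther-key = key-fallback ∘ toOther
      outside-absent : ∀ {b} → b ∈ outside → inj₁ (vertex b) ∉ S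
      outside-absent b∈outside = proj₂ (∈-filter⁻ (∁? inS?) b∈outside)
      joins : ∀ e → Joins (source e) (target e) (edgeRow e)
      joins e = proj₁ (proj₂ (orientedRow c-sym e))
      distinct-rows : ∀ {e e′} → source e ≢ source e′ × source e ≢ target e′ →
                      new (edgeRow e) ≢ new (edgeRow e′)
      distinct-rows {e} {e′} (≢source , ≢target) same
        with joins-source (joins e) (subst (Joins (source e′) (target e′)) (sym (new-injective same)) (joins e′))
      ... | inj₁ e≡ = ≢source e≡
      ... | inj₂ e≡ = ≢target e≡
      edgeRows-unique : Unique (map (new ∘ edgeRow) edges)
      edgeRows-unique =
        AllPairs.map⁺ {R = _≢_} {f = new ∘ edgeRow} (AllPairs.map (λ {e} {e′} → distinct-rows {e} {e′}) edges-fresh)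
      edgeRow-key : ∀ e → VertexKey (new (edgeRow e))
      edgeRow-key e with joins-first (joins e)
      ... | v , first≡ = v , trans (key-new (edgeRow e)) first≡
      vertex-keys : All VertexKey viaVertices
      vertex-keys = All.++⁺ (All.map⁺ {xs = inside} {f = inj₁ ∘ vertex} (All.tabulate λ {b} _ → b , refl))
                            (All.map⁺ {xs = edges} {f = new ∘ edgeRow} (All.tabulate λ {e} _ → edgeRow-key e))
      edge-witness : ∀ {e} → source e ∈ outside × target e ∈ outside → Witness C S (special j) (new (edgeRow e))
      edge-witness {e} (source∈ , target∈)
        with joins-absent (joins e) (outside-absent source∈) (outside-absent target∈)
      ... | first∉S , second∉S =
        leading (encode (edgeRow e)) (row-leads (edgeRow e) 2F (proj₂ (proj₂ (orientedRow c-sym e)))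
                                       λ { 0F _ → first∉S ; 1F _ → second∉S ; 2F (s≤s (s≤s ())) })
      lengths : length (specialRows j) + length (tabulate viaOther ++ viaVertices)
                ≡ (2 + s + spare j) + (2 + (length inside + length edges))
      lengths = cong₂ _+_ (length-specialRows j)
        (trans (length-++ (tabulate viaOther) {viaVertices})
               (cong₂ _+_ (length-tabulate viaOther)
                          (trans (length-++ (map (inj₁ ∘ vertex) inside) {map (new ∘ edgeRow) edges})
                                 (cong₂ _+_ (length-map (inj₁ ∘ vertex) inside) (length-map (new ∘ edgeRow) edges)))))
      count : ∀ {n m i o e d} → i + o ≡ n → o ≡ e + d → d ≤ 3 + m → 2 * n + 1 ≤ (2 + n + m) + (2 + (i + e))
      count {m = m} {i} {e = e} {d} refl refl d≤ = begin
        2 * (i + (e + d)) + 1                    ≡⟨ left i e d ⟩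
        (1 + 2 * i + 2 * e + d) + d              ≤⟨ +-monoʳ-≤ (1 + 2 * i + 2 * e + d) d≤ ⟩
        (1 + 2 * i + 2 * e + d) + (3 + m)        ≡⟨ right i e d m ⟩
        (2 + (i + (e + d)) + m) + (2 + (i + e))  ∎
        where
        open ≤-Reasoning
        left : ∀ i e d → 2 * (i + (e + d)) + 1 ≡ (1 + 2 * i + 2 * e + d) + d
        left = solve-∀
        right : ∀ i e d m → (1 + 2 * i + 2 * e + d) + (3 + m) ≡ (2 + (i + (e + d)) + m) + (2 + (i + e))
        right = solve-∀

  module _ (c-sym : Symmetric c) (no-clique : ∀ j → ¬ MonoClique c (suc (3 + spare j)) j) where

    candidates : ∀ S x → Candidates.CandidateList S x
    candidates S x with symbolView x
    ... | special-view j = specialCandidates c-sym no-clique S j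
    ... | vertex-view a  = vertexCandidates S a

    C-suitable : SuitableCore (2 * s + 1) C
    C-suitable = suitable-if-leading-rows C (2 * s + 1) λ S _ |S| x x∈S →
      Candidates.leadingRow S x x∈S |S| (candidates S x)

suitableCore : ∀ sp (spare : Fin 3 → ℕ) (c : Colouring (suc sp)) → Symmetric c →
               (∀ j → ¬ MonoClique c (suc (3 + spare j)) j) →
               Σ (Core ((suc sp + 3) * sp + ((3 + spare 0F) + (3 + spare 1F) + (3 + spare 2F))) (suc sp + 3))
                 (SuitableCore (2 * suc sp + 1))
suitableCore sp spare c c-sym no-clique =
  subst₂ (λ N v → Σ (Core N v) (SuitableCore (2 * suc sp + 1))) length-rows (+-comm 3 (suc sp))
         (C , C-suitable c-sym no-clique)
  where open Construction sp spare c

lemma7 : (s l : ℕ) → 1 ≤ s → 1 ≤ l →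
         (k₁ k₂ k₃ : ℕ) → 3 ≤ k₁ → 3 ≤ k₂ → 3 ≤ k₃ → k₁ + k₂ + k₃ ≡ l →
         Σ ℕ (λ R → IsRamseyNumber (suc k₁) (suc k₂) (suc k₃) R × s < R) →
         Σ (Core ((s + 3) * (s ∸ 1) + l) (s + 3)) (SuitableCore (2 * s + 1))
lemma7 (suc sp) _ _ _ _ _ _ (s≤s (s≤s (s≤s {n = m₁} z≤n))) (s≤s (s≤s (s≤s {n = m₂} z≤n)))
       (s≤s (s≤s (s≤s {n = m₃} z≤n))) refl (_ , (_ , minimal) , s<R) =
  fromColouring (avoidingColouring (minimal (suc sp) s<R))
  where
  spare : Fin 3 → ℕ
  spare 0F = m₁
  spare 1F = m₂
  spare 2F = m₃
  fromColouring : Σ (Colouring (suc sp)) (Avoids (4 + m₁) (4 + m₂) (4 + m₃)) →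
                  Σ (Core ((suc sp + 3) * sp + (3 + m₁ + (3 + m₂) + (3 + m₃))) (suc sp + 3))
                    (SuitableCore (2 * suc sp + 1))
  fromColouring (c , c-sym , ¬K₁ , ¬K₂ , ¬K₃) = suitableCore sp spare c c-sym λ where
    0F → ¬K₁
    1F → ¬K₂
    2F → ¬K₃
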